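{- Let $d$ be odd, $B_1,\dots,B_N$ arbitrary bubbles with colors $\{1,\dots,d\}$ and $n_1,\dots,n_N$ positive integers. Then no graph in $\mathcal{G}^{\max}_{n_1,\dots,n_N}(B_1,\dots,B_N)$ has a 4-edge-cut consisting of four edges of color 0.
   Context: A colored graph with colors $\{0,1,\dots,d\}$ is a finite connected bipartite graph (black/white vertices, multiple edges allowed) in which each edge carries a color in $\{0,\dots,d\}$ and each vertex has exactly one incident edge of each color. A bubble is a finite connected bipartite graph with edges colored in $\{1,\dots,d\}$, each vertex having exactly one incident edge of each color; the bubbles of a colored graph are the connected components after removing the color-0 edges. $\mathcal{G}_{n_1,\dots,n_N}(B_1,\dots,B_N)$ is the set of colored graphs whose bubbles are exactly $n_i$ copies of $B_i$. A bicolored cycle with colors $\{a,b\}$ is a connected component of the subgraph of edges of colors $a,b$; $C_0(G)$ is the number of bicolored cycles with colors $\{0,c\}$, $c=1,\dots,d$; $\mathcal{G}^{\max}_{n_1,\dots,n_N}(B_1,\dots,B_N)$ is the subset maximizing $C_0$. A $k$-edge-cut is a set of $k$ edges whose removal disconnects the graph while removing any proper subset does not. -}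

module Defs where

open import Data.Nat using (ℕ; zero; suc; _≤_)
open import Data.Fin using (Fin; zero; suc)
open import Data.Fin.Permutation using (Permutation′; _⟨$⟩ʳ_)
open import Data.Product using (Σ; Σ-syntax; ∃; _×_; _,_)
open import Data.Sum using (_⊎_)
open import Data.Unit using (⊤)
open import Data.List using (tabulate)
open import Data.Nat.ListAction using (sum)
open import Function.Bundles using (_↔_; Inverse; _⇔_)
open import Relation.Nullary using (¬_)
open import Relation.Binary.PropositionalEquality using (_≡_)
open import Relation.Binary.Construct.Closure.ReflexiveTransitive using (Star)

-- Vertices: black = inj₁ b, white = inj₂ w, with b w : Fin m.
-- For each colour c (of k colours) the edges of colour c form a perfect
-- matching given by a permutation ρ c: black b is joined to white ρ c b.
-- An edge is identified by its colour and its black endpoint (c , b);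
-- multiple edges (same endpoints, different colours) are allowed.
-- 'allowed c b' selects which edges are kept (sub-graph on all vertices).

Vert : ℕ → Set
Vert m = Fin m ⊎ Fin m

data Step {k m : ℕ} (ρ : Fin k → Permutation′ m) (allowed : Fin k → Fin m → Set)
          : Vert m → Vert m → Set where
  bw : ∀ c b → allowed c b → Step ρ allowed (Data.Sum.inj₁ b) (Data.Sum.inj₂ (ρ c ⟨$⟩ʳ b))
  wb : ∀ c b → allowed c b → Step ρ allowed (Data.Sum.inj₂ (ρ c ⟨$⟩ʳ b)) (Data.Sum.inj₁ b)

Reach : {k m : ℕ} → (Fin k → Permutation′ m) → (Fin k → Fin m → Set) → Vert m → Vert m → Set
Reach ρ allowed = Star (Step ρ allowed)

Connected : {k m : ℕ} → (Fin k → Permutation′ m) → (Fin k → Fin m → Set) → Set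
Connected ρ allowed = ∀ u v → Reach ρ allowed u v

allEdges : {k m : ℕ} → Fin k → Fin m → Set
allEdges _ _ = ⊤

-- The selected subgraph has exactly 'count' connected components:
-- a surjective labelling of vertices by Fin count whose fibres are
-- exactly the components.
NumComponents : {k m : ℕ} → (Fin k → Permutation′ m) → (Fin k → Fin m → Set) → ℕ → Set
NumComponents {m = m} ρ allowed count =
  Σ[ f ∈ (Vert m → Fin count) ]
    ((∀ y → ∃ λ x → f x ≡ y) ×
     (∀ u v → (f u ≡ f v) ⇔ Reach ρ allowed u v))

-- Bubbles with colours {1,…,d} (encoded as Fin d; colour i+1 ↦ i).

record Bubble (d : ℕ) : Set where
  field
    size      : ℕ                      -- number of black (= white) vertices
    nonempty  : 1 ≤ size
    τ         : Fin d → Permutation′ size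
    connected : Connected τ allEdges

-- Coloured graphs with colours {0,…,d} (encoded as Fin (suc d)).

record ColGraph (d : ℕ) : Set where
  field
    size      : ℕ
    nonempty  : 1 ≤ size
    σ         : Fin (suc d) → Permutation′ size
    connected : Connected σ allEdges

-- 𝒢_{n_1..n_N}(B_1..B_N): the subgraph of colours 1..d (i.e. the union of
-- the bubbles) is isomorphic (preserving colours and black/white) to the
-- disjoint union of ns i copies of B i, i.e. the bubbles are exactly
-- ns i copies of B i.

Copies : {d N : ℕ} → (Fin N → Bubble d) → (Fin N → ℕ) → Set
Copies {N = N} B ns = Σ[ i ∈ Fin N ] (Fin (ns i) × Fin (Bubble.size (B i)))

copyStep : {d N : ℕ} (B : Fin N → Bubble d) (ns : Fin N → ℕ) → Fin d → Copies B ns → Copies B ns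
copyStep B ns c (i , j , x) = i , j , (Bubble.τ (B i) c ⟨$⟩ʳ x)

In𝒢 : {d N : ℕ} → (Fin N → Bubble d) → (Fin N → ℕ) → ColGraph d → Set
In𝒢 B ns G =
  Σ[ φ ∈ (Fin (ColGraph.size G) ↔ Copies B ns) ]     -- black vertices
  Σ[ ψ ∈ (Fin (ColGraph.size G) ↔ Copies B ns) ]     -- white vertices
    (∀ c b → Inverse.to ψ (ColGraph.σ G (suc c) ⟨$⟩ʳ b)
              ≡ copyStep B ns c (Inverse.to φ b))

-- C_0(G) = Σ_{c=1}^{d} #(bicoloured cycles with colours {0,c}),
-- i.e. connected components of the subgraph of edges of colours 0 and c.

colours0c : {d m : ℕ} → Fin d → Fin (suc d) → Fin m → Set
colours0c c c' _ = c' ≡ zero ⊎ c' ≡ suc c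

HasC0 : {d : ℕ} → ColGraph d → ℕ → Set
HasC0 {d} G total =
  Σ[ ks ∈ (Fin d → ℕ) ]
    ((∀ c → NumComponents (ColGraph.σ G) (colours0c c) (ks c)) ×
     sum (tabulate ks) ≡ total)

In𝒢max : {d N : ℕ} → (Fin N → Bubble d) → (Fin N → ℕ) → ColGraph d → Set
In𝒢max {d} B ns G =
  In𝒢 B ns G ×
  (∀ (G' : ColGraph d) → In𝒢 B ns G' →
     ∀ m m' → HasC0 G m → HasC0 G' m' → m' ≤ m)

-- Edge cuts.  An edge set is a predicate E on edges (c , b).
-- E is an edge cut if removing it disconnects G while removing any
-- proper subset S ⊊ E does not.

removing : {d m : ℕ} → (Fin (suc d) → Fin m → Set) → Fin (suc d) → Fin m → Set
removing S c b = ¬ S c b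

IsEdgeCut : {d : ℕ} (G : ColGraph d) → (Fin (suc d) → Fin (ColGraph.size G) → Set) → Set₁
IsEdgeCut G E =
  ¬ Connected (ColGraph.σ G) (removing E) ×
  (∀ (S : Fin _ → Fin (ColGraph.size G) → Set) →
     (∀ {c b} → S c b → E c b) →
     ¬ (∀ {c b} → E c b → S c b) →
     Connected (ColGraph.σ G) (removing S))

Colour0Edges4 : {d m : ℕ} → Fin m → Fin m → Fin m → Fin m → Fin (suc d) → Fin m → Set
Colour0Edges4 b₁ b₂ b₃ b₄ c b = c ≡ zero × (b ≡ b₁ ⊎ b ≡ b₂ ⊎ b ≡ b₃ ⊎ b ≡ b₄)

HasColour0FourEdgeCut : {d : ℕ} → ColGraph d → Set₁
HasColour0FourEdgeCut G =
  Σ[ b₁ ∈ Fin (ColGraph.size G) ] Σ[ b₂ ∈ Fin (ColGraph.size G) ]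
  Σ[ b₃ ∈ Fin (ColGraph.size G) ] Σ[ b₄ ∈ Fin (ColGraph.size G) ]
    (¬ b₁ ≡ b₂ × ¬ b₁ ≡ b₃ × ¬ b₁ ≡ b₄ × ¬ b₂ ≡ b₃ × ¬ b₂ ≡ b₄ × ¬ b₃ ≡ b₄ ×
     IsEdgeCut G (Colour0Edges4 b₁ b₂ b₃ b₄))

module Submission where

-- For each colour c the {0,c}-cycles of G are the cycles of a permutation
-- 'next' of the vertices.  Suppose the colour-0 edges at the black
-- vertices p₀,…,p₃ form a cut.  Swapping the colour-0 partners of two of
-- them, pⱼ and pₖ, gives a graph G′ with the same bubbles, connected by
-- minimality of the cut.  Per colour this composes 'next' with a
-- transposition, which splits the cycle of pⱼ if pₖ lies on it and merges
-- the two cycles otherwise.  Maximality of C₀ then forces pⱼ, pₖ to share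
-- fewer than d/2 of the d cycles through pⱼ (d is odd).  On the other hand
-- the cut has two sides and each cut edge crosses between them, so for
-- every colour the cycle through pⱼ returns through a cut vertex on the
-- other side; a short count over the possible side patterns of four points
-- contradicts the bound.

open import Defs
open import Data.Nat using (ℕ; zero; suc; _+_; _*_; _≤_; _<_; _%_; _/_; z≤n; s≤s; NonZero)
open import Data.Nat.Properties
  using ( +-comm; +-suc; +-identityʳ; n<1+n; m≤n⇒∃[o]m+o≡n; +-mono-≤; +-monoʳ-≤; +-monoˡ-≤
        ; +-cancelˡ-≤; ≤-trans; ≤-reflexive; ≤∧≢⇒<; m≤m+n; m≤n+m; <-irrefl; 0≢1+n; module ≤-Reasoning)
open import Data.Nat.DivMod using (m≡m%n+[m/n]*n; m%n<n)
open import Data.Nat.GeneralisedArithmetic using (iterate)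
open import Data.Nat.ListAction using (sum)
open import Data.Nat.Solver using (module +-*-Solver)
open import Data.List using (tabulate)
open import Data.List.Properties using (tabulate-cong)
open import Data.Bool using (Bool; true; false; not; if_then_else_)
import Data.Bool.Properties as Boolₚ
open import Data.Fin using (Fin; zero; suc; toℕ; fromℕ<; join; splitAt; punchIn; punchOut)
open import Data.Fin.Patterns using (0F; 1F; 2F; 3F)
import Data.Fin.Properties as Finₚ
open import Data.Fin.Permutation using (Permutation′; _⟨$⟩ʳ_; _⟨$⟩ˡ_; inverseˡ; inverseʳ; transpose; _∘ₚ_)
open import Data.Sum using (_⊎_; inj₁; inj₂)
import Data.Sum as Sum
import Data.Sum.Properties as Sumₚ
open import Data.Product using (Σ; ∃; _×_; _,_; proj₁; proj₂)
open import Data.Unit using (tt)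
open import Data.Empty using (⊥)
open import Function.Base using (_∘_; _on_)
open import Function.Bundles using (_⇔_; mk⇔; Equivalence)
open import Function.Definitions using (Injective)
open import Relation.Nullary using (¬_; Dec; yes; no; does; contradiction)
open import Relation.Nullary.Decidable
  using (True; toWitness; ¬?; _×-dec_; _⊎-dec_; _→-dec_; dec-true; dec-false)
open import Relation.Binary.Core using (Rel)
open import Relation.Binary.Definitions using (Decidable; DecidableEquality)
open import Relation.Binary.Structures using (IsEquivalence)
import Relation.Binary.Construct.On as On
open import Relation.Binary.PropositionalEquality
  using (_≡_; _≢_; refl; sym; trans; cong; cong₂; subst; subst₂; module ≡-Reasoning)
open import Relation.Binary.Construct.Closure.ReflexiveTransitive using (ε; _◅_; _◅◅_)
import Relation.Binary.Construct.Closure.ReflexiveTransitive as Star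

open Equivalence using (to; from)

iterate-+ : ∀ {A : Set} (f : A → A) x m n →
            iterate f x (m + n) ≡ iterate f (iterate f x m) n
iterate-+ f x zero    n = refl
iterate-+ f x (suc m) n = iterate-+ f (f x) m n

iterate-suc : ∀ {A : Set} (f : A → A) x n → iterate f x (suc n) ≡ f (iterate f x n)
iterate-suc f x zero    = refl
iterate-suc f x (suc n) = iterate-suc f (f x) n

iterate-injective : ∀ {A : Set} {f : A → A} → Injective _≡_ _≡_ f →
                    ∀ n → Injective _≡_ _≡_ (λ x → iterate f x n)
iterate-injective f-inj zero    e = e
iterate-injective f-inj (suc n) e = f-inj (iterate-injective f-inj n e)

iterate-preserves : ∀ {A : Set} (f : A → A) (K : A → Set) → (∀ a → K a → K (f a)) →
                    ∀ n {a} → K a → K (iterate f a n)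
iterate-preserves f K pres zero    k = k
iterate-preserves f K pres (suc n) k = iterate-preserves f K pres n (pres _ k)

iterate-period : ∀ {A : Set} (f : A → A) {u} P → iterate f u P ≡ u →
                 ∀ q → iterate f u (q * P) ≡ u
iterate-period f P ret zero    = refl
iterate-period f {u} P ret (suc q) = begin
  iterate f u (P + q * P)              ≡⟨ iterate-+ f u P (q * P) ⟩
  iterate f (iterate f u P) (q * P)    ≡⟨ cong (λ z → iterate f z (q * P)) ret ⟩
  iterate f u (q * P)                  ≡⟨ iterate-period f P ret q ⟩
  u                                    ∎
  where open ≡-Reasoning

-- Pigeonhole: an injective self-map of a type that embeds into a finite
-- type has every point periodic.
periodic : ∀ {A : Set} {N} (code : A → Fin N) → Injective _≡_ _≡_ code →
           (f : A → A) → Injective _≡_ _≡_ f →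
           ∀ u → ∃ λ p → iterate f u (suc p) ≡ u
periodic {N = N} code code-inj f f-inj u
  with Finₚ.pigeonhole (n<1+n N) (λ (i : Fin (suc N)) → code (iterate f u (toℕ i)))
... | i , j , i<j , same with m≤n⇒∃[o]m+o≡n i<j
...   | p , i+1+p≡j = p , sym (iterate-injective f-inj (toℕ i) returns)
  where
    open ≡-Reasoning
    returns : iterate f u (toℕ i) ≡ iterate f (iterate f u (suc p)) (toℕ i)
    returns = begin
      iterate f u (toℕ i)                         ≡⟨ code-inj same ⟩
      iterate f u (toℕ j)                         ≡⟨ cong (iterate f u) (sym i+1+p≡j) ⟩
      iterate f u (suc (toℕ i + p))               ≡⟨ cong (λ n → iterate f u (suc n)) (+-comm (toℕ i) p) ⟩
      iterate f u (suc p + toℕ i)                 ≡⟨ iterate-+ f u (suc p) (toℕ i) ⟩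
      iterate f (iterate f u (suc p)) (toℕ i)     ∎

iterate-mod : ∀ {A : Set} (f : A → A) {u} P .{{_ : NonZero P}} → iterate f u P ≡ u →
              ∀ n → iterate f u (n % P) ≡ iterate f u n
iterate-mod f {u} P ret n = begin
  iterate f u (n % P)                               ≡⟨ cong (λ z → iterate f z (n % P)) (sym (iterate-period f P ret (n / P))) ⟩
  iterate f (iterate f u ((n / P) * P)) (n % P)     ≡⟨ sym (iterate-+ f u ((n / P) * P) (n % P)) ⟩
  iterate f u ((n / P) * P + n % P)                 ≡⟨ cong (iterate f u) (trans (+-comm ((n / P) * P) (n % P)) (sym (m≡m%n+[m/n]*n n P))) ⟩
  iterate f u n                                     ∎
  where open ≡-Reasoning

cycle-avoids : ∀ {A : Set} (g : A → A) {a t} k → iterate g (g a) k ≡ a → a ≢ t →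
               (∀ i → i < k → iterate g (g a) i ≢ t) → ∀ n → iterate g a n ≢ t
cycle-avoids g {a} {t} k ret a≢t trip≢t n e =
  avoids-before-return (n % suc k) (m%n<n n (suc k)) (trans (iterate-mod g (suc k) ret n) e)
  where
    avoids-before-return : ∀ r → r < suc k → iterate g a r ≢ t
    avoids-before-return zero    _         = a≢t
    avoids-before-return (suc i) (s≤s i<k) = trip≢t i i<k

first-switch : (Q : ℕ → Set) → (∀ i → Dec (Q i)) → ¬ Q 0 → ∀ n → Q n → ∃ λ i → ¬ Q i × Q (suc i)
first-switch Q Q? ¬Q0 zero    Qn = contradiction Qn ¬Q0
first-switch Q Q? ¬Q0 (suc n) Qn with Q? 1
... | yes Q1 = 0 , ¬Q0 , Q1
... | no ¬Q1 with first-switch (Q ∘ suc) (Q? ∘ suc) ¬Q1 n Qn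
...   | i , ¬Qi , Qi+1 = suc i , ¬Qi , Qi+1

module Orbits {A : Set} (_≟_ : DecidableEquality A) (f : A → A)
              (f-inj : Injective _≡_ _≡_ f)
              (period : ∀ u → ∃ λ p → iterate f u (suc p) ≡ u) where

  Orbit : A → A → Set
  Orbit u v = ∃ λ n → iterate f u n ≡ v

  orbit-refl : ∀ {u} → Orbit u u
  orbit-refl = 0 , refl

  orbit-trans : ∀ {u v w} → Orbit u v → Orbit v w → Orbit u w
  orbit-trans {u} (m , refl) (n , refl) = m + n , iterate-+ f u m n

  orbit-step : ∀ {u} → Orbit u (f u)
  orbit-step = 1 , refl

  orbit-back : ∀ {u} → Orbit (f u) u
  orbit-back {u} = period u

  orbit-sym : ∀ {u v} → Orbit u v → Orbit v u
  orbit-sym (zero  , refl) = orbit-refl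
  orbit-sym (suc n , e)    = orbit-trans (orbit-sym (n , e)) orbit-back

  orbit-within-period : ∀ {u v} → Orbit u v →
                        ∃ λ (i : Fin (suc (proj₁ (period u)))) → iterate f u (toℕ i) ≡ v
  orbit-within-period {u} (n , e) = fromℕ< r<P , (begin
    iterate f u (toℕ (fromℕ< r<P))  ≡⟨ cong (iterate f u) (Finₚ.toℕ-fromℕ< r<P) ⟩
    iterate f u (n % P)              ≡⟨ iterate-mod f P (proj₂ (period u)) n ⟩
    iterate f u n                    ≡⟨ e ⟩
    _                                ∎)
    where
      open ≡-Reasoning
      P = suc (proj₁ (period u))
      r<P : n % P < P
      r<P = m%n<n n P

  orbit? : ∀ u v → Dec (Orbit u v)
  orbit? u v with Finₚ.any? (λ (i : Fin (suc (proj₁ (period u)))) → iterate f u (toℕ i) ≟ v)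
  ... | yes (i , e) = yes (toℕ i , e)
  ... | no none     = no (λ o → none (orbit-within-period o))

-- 'Classes R k': a surjective labelling by Fin k whose fibres are exactly
-- the R-related pairs, i.e. R has exactly k classes.  For the relation
-- 'Reach' this is NumComponents.
Classes : {A : Set} → Rel A _ → ℕ → Set
Classes {A} R k = Σ (A → Fin k) λ label →
  (∀ i → ∃ λ x → label x ≡ i) × (∀ u v → (label u ≡ label v) ⇔ R u v)

classes-resp : ∀ {A : Set} {R S : Rel A _} {k} → (∀ u v → R u v ⇔ S u v) → Classes R k → Classes S k
classes-resp R⇔S (label , onto , fibres) =
  label , onto , λ u v → mk⇔ (λ e → to (R⇔S u v) (to (fibres u v) e))
                              (λ s → from (fibres u v) (from (R⇔S u v) s))

-- The number of classes is well defined: labellings by Fin k and Fin k'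
-- give injections both ways.
classes-unique : ∀ {A : Set} {R : Rel A _} {k k′} → Classes R k → Classes R k′ → k ≡ k′
classes-unique L L′ = Finₚ.cantor-schröder-bernstein (transfer-injective L L′) (transfer-injective L′ L)
  where
    transfer : ∀ {k k′} → Classes _ k → Classes _ k′ → Fin k → Fin k′
    transfer (_ , onto , _) (label′ , _ , _) i = label′ (proj₁ (onto i))
    transfer-injective : ∀ {k k′} (L : Classes _ k) (L′ : Classes _ k′) → Injective _≡_ _≡_ (transfer L L′)
    transfer-injective (label , onto , fibres) (label′ , _ , fibres′) {i} {j} e
      with onto i | onto j
    ... | x , refl | y , refl = from (fibres x y) (to (fibres′ x y) e)

-- Every decidable equivalence relation on Fin N has a class labelling:
-- recursion on N, deciding whether the new element 0 joins an old class.
classes-Fin : ∀ N (R : Rel (Fin N) _) → IsEquivalence R → Decidable R → ∃ (Classes R)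
classes-Fin zero R _ _ = 0 , (λ ()) , (λ ()) , (λ ())
classes-Fin (suc N) R eq R? with classes-Fin N (R on suc) (On.isEquivalence suc eq) (On.decidable suc R R?)
                               | Finₚ.any? (λ i → R? zero (suc i))
... | k , label , onto , fibres | yes (i , 0Ri) = k , label′ , onto′ , fibres′
  where
    open IsEquivalence eq renaming (refl to R-refl; sym to R-sym; trans to R-trans)
    label′ : Fin (suc N) → Fin k
    label′ zero    = label i
    label′ (suc j) = label j
    onto′ : ∀ c → ∃ λ x → label′ x ≡ c
    onto′ c = suc (proj₁ (onto c)) , proj₂ (onto c)
    fibres′ : ∀ u v → (label′ u ≡ label′ v) ⇔ R u v
    fibres′ zero    zero    = mk⇔ (λ _ → R-refl) (λ _ → refl)
    fibres′ zero    (suc j) = mk⇔ (λ e → R-trans 0Ri (to (fibres i j) e))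
                                  (λ r → from (fibres i j) (R-trans (R-sym 0Ri) r))
    fibres′ (suc j) zero    = mk⇔ (λ e → R-sym (to (fibres′ zero (suc j)) (sym e)))
                                  (λ r → sym (from (fibres′ zero (suc j)) (R-sym r)))
    fibres′ (suc j) (suc l) = fibres j l
... | k , label , onto , fibres | no isolated = suc k , label′ , onto′ , fibres′
  where
    open IsEquivalence eq renaming (refl to R-refl; sym to R-sym)
    label′ : Fin (suc N) → Fin (suc k)
    label′ zero    = zero
    label′ (suc j) = suc (label j)
    onto′ : ∀ c → ∃ λ x → label′ x ≡ c
    onto′ zero    = zero , refl
    onto′ (suc c) = suc (proj₁ (onto c)) , cong suc (proj₂ (onto c))
    fibres′ : ∀ u v → (label′ u ≡ label′ v) ⇔ R u v
    fibres′ zero    zero    = mk⇔ (λ _ → R-refl) (λ _ → refl)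
    fibres′ zero    (suc j) = mk⇔ (λ ()) (λ r → contradiction (j , r) isolated)
    fibres′ (suc j) zero    = mk⇔ (λ ()) (λ r → contradiction (j , R-sym r) isolated)
    fibres′ (suc j) (suc l) = mk⇔ (λ e → to (fibres j l) (Finₚ.suc-injective e))
                                  (λ r → cong suc (from (fibres j l) r))

classes-⊎ : ∀ m (R : Rel (Fin m ⊎ Fin m) _) → IsEquivalence R → Decidable R → ∃ (Classes R)
classes-⊎ m R eq R? with classes-Fin (m + m) (R on splitAt m) (On.isEquivalence (splitAt m) eq) (On.decidable (splitAt m) R R?)
... | k , label , onto , fibres = k , label ∘ join m m , onto′ , fibres′
  where
    split-join : ∀ v → splitAt m (join m m v) ≡ v
    split-join = Finₚ.splitAt-join m m
    onto′ : ∀ c → ∃ λ x → label (join m m x) ≡ c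
    onto′ c = splitAt m (proj₁ (onto c)) , trans (cong label (Finₚ.join-splitAt m m _)) (proj₂ (onto c))
    fibres′ : ∀ u v → (label (join m m u) ≡ label (join m m v)) ⇔ R u v
    fibres′ u v = mk⇔ (λ e → subst₂ R (split-join u) (split-join v) (to (fibres (join m m u) (join m m v)) e))
                      (λ r → from (fibres (join m m u) (join m m v)) (subst₂ R (sym (split-join u)) (sym (split-join v)) r))

module AvoidingWalks {A : Set} (_≟_ : DecidableEquality A) (x y : A) where

  Avoids : (A → A) → A → ℕ → Set
  Avoids g a n = ∀ i → i < n → iterate g a i ≢ x × iterate g a i ≢ y

  Walk : (A → A) → A → A → Set
  Walk g a b = ∃ λ n → iterate g a n ≡ b × Avoids g a n

  walk-orbit : ∀ {g a b} → Walk g a b → ∃ λ n → iterate g a n ≡ b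
  walk-orbit (n , e , _) = n , e

  walk-cons : ∀ {g a c} → a ≢ x → a ≢ y → Walk g (g a) c → Walk g a c
  walk-cons a≢x a≢y (k , e , av) = suc k , e , λ { zero _ → a≢x , a≢y ; (suc i) (s≤s i<k) → av i i<k }

  first-hit : ∀ g n {a b} → iterate g a n ≡ b → Walk g a b ⊎ Walk g a x ⊎ Walk g a y
  first-hit g zero e = inj₁ (0 , e , λ _ ())
  first-hit g (suc n) {a} e with a ≟ x | a ≟ y
  ... | yes a≡x | _       = inj₂ (inj₁ (0 , a≡x , λ _ ()))
  ... | no _    | yes a≡y = inj₂ (inj₂ (0 , a≡y , λ _ ()))
  ... | no a≢x  | no a≢y  = Sum.map cons (Sum.map cons cons) (first-hit g n e)
    where cons : ∀ {c} → Walk g (g a) c → Walk g a c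
          cons = walk-cons a≢x a≢y

  module _ (g h : A → A) (agree : ∀ u → u ≢ x → u ≢ y → g u ≡ h u) where

    transfer-avoids : ∀ n a → Avoids g a n → iterate h a n ≡ iterate g a n × Avoids h a n
    transfer-avoids zero    a av = refl , λ _ ()
    transfer-avoids (suc n) a av with av 0 (s≤s z≤n) | transfer-avoids n (g a) (λ i i<n → av (suc i) (s≤s i<n))
    ... | a≢x , a≢y | same , av′ =
      trans (cong (λ z → iterate h z n) (sym ga≡ha)) same ,
      λ { zero _ → a≢x , a≢y ; (suc i) (s≤s i<n) → subst (λ z → iterate h z i ≢ x × iterate h z i ≢ y) ga≡ha (av′ i i<n) }
      where ga≡ha = agree a a≢x a≢y

    transfer-walk : ∀ {a b} → Walk g a b → Walk h a b
    transfer-walk {a} (n , e , av) with transfer-avoids n a av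
    ... | same , av′ = n , trans same e , av′

-- s′ is s composed with the transposition of x and y: it agrees with s
-- away from x and y, while s′ x = s y and s′ y = s x.
module Transposed {A : Set} (_≟_ : DecidableEquality A) (s s′ : A → A)
    (s-inj : Injective _≡_ _≡_ s) (s-per : ∀ u → ∃ λ p → iterate s u (suc p) ≡ u)
    (s′-inj : Injective _≡_ _≡_ s′) (s′-per : ∀ u → ∃ λ p → iterate s′ u (suc p) ≡ u)
    (x y : A) (x≢y : x ≢ y) (agree : ∀ u → u ≢ x → u ≢ y → s u ≡ s′ u)
    (s′x : s′ x ≡ s y) (s′y : s′ y ≡ s x) where

  open Orbits _≟_ s s-inj s-per
  module ′ = Orbits _≟_ s′ s′-inj s′-per
  open AvoidingWalks _≟_ x y

  walk′ : ∀ {a b} → Walk s a b → ′.Orbit a b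
  walk′ w = walk-orbit (transfer-walk s s′ agree w)

  -- Points of different s-cycles: the s-walk from s y back to y avoids x,
  -- so it is also an s′-walk, and s′ x = s y joins x to y.
  separated⇒joined : ¬ Orbit x y → ′.Orbit x y
  separated⇒joined x≁y with orbit-back {y}
  ... | n , e with first-hit s n e
  ...   | inj₁ w        = ′.orbit-trans (1 , s′x) (walk′ w)
  ...   | inj₂ (inj₁ w) = contradiction (orbit-sym (orbit-trans orbit-step (walk-orbit w))) x≁y
  ...   | inj₂ (inj₂ w) = ′.orbit-trans (1 , s′x) (walk′ w)

  module _ (x∼y : Orbit x y) where

    -- Every s′-step stays on an s-cycle, so s′-cycles refine s-cycles.
    step′-in-orbit : ∀ a → Orbit a (s′ a)
    step′-in-orbit a with a ≟ x | a ≟ y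
    ... | yes refl | _       = subst (Orbit a) (sym s′x) (orbit-trans x∼y orbit-step)
    ... | no _     | yes refl = subst (Orbit a) (sym s′y) (orbit-trans (orbit-sym x∼y) orbit-step)
    ... | no a≢x   | no a≢y   = subst (Orbit a) (agree a a≢x a≢y) orbit-step

    orbit′⇒orbit : ∀ {u v} → ′.Orbit u v → Orbit u v
    orbit′⇒orbit {u} (n , refl) =
      iterate-preserves s′ (Orbit u) (λ a u∼a → orbit-trans u∼a (step′-in-orbit a)) n orbit-refl

    -- The s-walk from s y onwards reaches x before returning to y
    -- (otherwise the cycle of y would avoid x).
    return-walk : Walk s (s y) x
    return-walk with orbit-sym x∼y
    ... | zero  , y≡x = contradiction (sym y≡x) x≢y
    ... | suc n , e with first-hit s n e
    ...   | inj₁ w                       = w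
    ...   | inj₂ (inj₁ w)                = w
    ...   | inj₂ (inj₂ (k , ret , avoid)) =
            contradiction e (cycle-avoids s k ret (λ y≡x → x≢y (sym y≡x)) (λ i i<k → proj₁ (avoid i i<k)) (suc n))

    -- Hence the s′-cycle of x is s′ x = s y, …, x and misses y.
    x≁′y : ¬ ′.Orbit x y
    x≁′y (n , e) with subst (λ z → Walk s′ z x) (sym s′x) (transfer-walk s s′ agree return-walk)
    ... | k , ret , avoid = cycle-avoids s′ k ret x≢y (λ i i<k → proj₂ (avoid i i<k)) n e

    orbit-x⇒′ : ∀ {u} → Orbit u x → ′.Orbit u x ⊎ ′.Orbit u y
    orbit-x⇒′ (n , e) with first-hit s n e
    ... | inj₁ w        = inj₁ (walk′ w)
    ... | inj₂ (inj₁ w) = inj₁ (walk′ w)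
    ... | inj₂ (inj₂ w) = inj₂ (walk′ w)

    away⇒′ : ∀ {u v} → ¬ Orbit u x → Orbit u v → ′.Orbit u v
    away⇒′ u≁x (n , e) with first-hit s n e
    ... | inj₁ w        = walk′ w
    ... | inj₂ (inj₁ w) = contradiction (walk-orbit w) u≁x
    ... | inj₂ (inj₂ w) = contradiction (orbit-trans (walk-orbit w) (orbit-sym x∼y)) u≁x

    kept : ∀ {u v} → ¬ ′.Orbit u y → ¬ ′.Orbit v y → Orbit u v → ′.Orbit u v
    kept {u} u≁′y v≁′y u∼v with orbit? u x
    ... | no u≁x  = away⇒′ u≁x u∼v
    ... | yes u∼x with orbit-x⇒′ u∼x | orbit-x⇒′ (orbit-trans (orbit-sym u∼v) u∼x)
    ...   | inj₂ u∼′y | _         = contradiction u∼′y u≁′y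
    ...   | inj₁ _    | inj₂ v∼′y = contradiction v∼′y v≁′y
    ...   | inj₁ u∼′x | inj₁ v∼′x = ′.orbit-trans u∼′x (′.orbit-sym v∼′x)

    -- The s′-cycle of y gets the new label zero; every other point keeps
    -- its old label (shifted).
    split-classes : ∀ {k} → Classes Orbit k → Classes ′.Orbit (suc k)
    split-classes {k} (label , onto , fibres) = label′ , onto′ , fibres′
      where
        mark : ∀ v → Dec (′.Orbit v y) → Fin (suc k)
        mark v (yes _) = zero
        mark v (no _)  = suc (label v)

        label′ : A → Fin (suc k)
        label′ v = mark v (′.orbit? v y)

        label′-y : ∀ {v} → ′.Orbit v y → label′ v ≡ zero
        label′-y {v} v∼′y with ′.orbit? v y
        ... | yes _    = refl
        ... | no v≁′y = contradiction v∼′y v≁′y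

        label′-old : ∀ {v} → ¬ ′.Orbit v y → label′ v ≡ suc (label v)
        label′-old {v} v≁′y with ′.orbit? v y
        ... | yes v∼′y = contradiction v∼′y v≁′y
        ... | no _     = refl

        -- An old class meeting the cycle of y also contains x, which is off it.
        onto′ : ∀ c → ∃ λ v → label′ v ≡ c
        onto′ zero = y , label′-y ′.orbit-refl
        onto′ (suc c) with onto c
        ... | v , refl with ′.orbit? v y
        ...   | no v≁′y  = v , label′-old v≁′y
        ...   | yes v∼′y = x , trans (label′-old x≁′y)
                                 (cong suc (from (fibres x v) (orbit-trans x∼y (orbit′⇒orbit (′.orbit-sym v∼′y)))))

        fibres′ : ∀ u v → (label′ u ≡ label′ v) ⇔ ′.Orbit u v
        fibres′ u v with ′.orbit? u y | ′.orbit? v y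
        ... | yes u∼′y | yes v∼′y = mk⇔ (λ _ → ′.orbit-trans u∼′y (′.orbit-sym v∼′y)) (λ _ → refl)
        ... | yes u∼′y | no v≁′y  = mk⇔ (λ ()) (λ u∼′v → contradiction (′.orbit-trans (′.orbit-sym u∼′v) u∼′y) v≁′y)
        ... | no u≁′y  | yes v∼′y = mk⇔ (λ ()) (λ u∼′v → contradiction (′.orbit-trans u∼′v v∼′y) u≁′y)
        ... | no u≁′y  | no v≁′y  = mk⇔ (λ e → kept u≁′y v≁′y (to (fibres u v) (Finₚ.suc-injective e)))
                                        (λ u∼′v → cong suc (from (fibres u v) (orbit′⇒orbit u∼′v)))

-- Transposing two points of one cycle splits it into two cycles; transposing
-- points of different cycles merges those two (apply the splitting to s′).
module Transposition {A : Set} (_≟_ : DecidableEquality A) (s s′ : A → A)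
    (s-inj : Injective _≡_ _≡_ s) (s-per : ∀ u → ∃ λ p → iterate s u (suc p) ≡ u)
    (s′-inj : Injective _≡_ _≡_ s′) (s′-per : ∀ u → ∃ λ p → iterate s′ u (suc p) ≡ u)
    (x y : A) (x≢y : x ≢ y) (agree : ∀ u → u ≢ x → u ≢ y → s u ≡ s′ u)
    (s′x : s′ x ≡ s y) (s′y : s′ y ≡ s x) where

  open Orbits _≟_ s s-inj s-per
  module ′ = Orbits _≟_ s′ s′-inj s′-per
  private
    module Forward  = Transposed _≟_ s s′ s-inj s-per s′-inj s′-per x y x≢y agree s′x s′y
    module Backward = Transposed _≟_ s′ s s′-inj s′-per s-inj s-per x y x≢y
                                 (λ u u≢x u≢y → sym (agree u u≢x u≢y)) (sym s′y) (sym s′x)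

  count-joined : ∀ {k k′} → Orbit x y → Classes Orbit k → Classes ′.Orbit k′ → k′ ≡ suc k
  count-joined x∼y L L′ = classes-unique L′ (Forward.split-classes x∼y L)

  count-separated : ∀ {k k′} → ¬ Orbit x y → Classes Orbit k → Classes ′.Orbit k′ → k ≡ suc k′
  count-separated x≁y L L′ = classes-unique L (Backward.split-classes (Forward.separated⇒joined x≁y) L′)

_≟V_ : ∀ {m} → DecidableEquality (Vert m)
_≟V_ = Sumₚ.≡-dec Finₚ._≟_ Finₚ._≟_

join-injective : ∀ m → Injective _≡_ _≡_ (join m m)
join-injective m {u} {v} e = begin
  u                         ≡⟨ sym (Finₚ.splitAt-join m m u) ⟩
  splitAt m (join m m u)    ≡⟨ cong (splitAt m) e ⟩
  splitAt m (join m m v)    ≡⟨ Finₚ.splitAt-join m m v ⟩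
  v                         ∎
  where open ≡-Reasoning

step-sym : ∀ {k m} {ρ : Fin k → Permutation′ m} {S : Fin k → Fin m → Set} {u v} →
           Step ρ S u v → Step ρ S v u
step-sym (bw c b p) = wb c b p
step-sym (wb c b p) = bw c b p

reach-sym : ∀ {k m} {ρ : Fin k → Permutation′ m} {S : Fin k → Fin m → Set} {u v} →
            Reach ρ S u v → Reach ρ S v u
reach-sym = Star.reverse step-sym

step-from-white : ∀ {k m} (ρ : Fin k → Permutation′ m) {S : Fin k → Fin m → Set} c w →
                  S c (ρ c ⟨$⟩ˡ w) → Step ρ S (inj₂ w) (inj₁ (ρ c ⟨$⟩ˡ w))
step-from-white ρ {S} c w p =
  subst (λ z → Step ρ S (inj₂ z) (inj₁ (ρ c ⟨$⟩ˡ w))) (inverseʳ (ρ c)) (wb c (ρ c ⟨$⟩ˡ w) p)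

-- The {0,c}-cycles of a coloured graph are the cycles of the permutation
-- 'next' of the vertices: leave a black vertex along colour 0 and a white
-- vertex along colour c.
module BicolouredCycles {d m : ℕ} (σ : Fin (suc d) → Permutation′ m) (c : Fin d) where

  next : Vert m → Vert m
  next (inj₁ b) = inj₂ (σ zero ⟨$⟩ʳ b)
  next (inj₂ w) = inj₁ (σ (suc c) ⟨$⟩ˡ w)

  next-injective : Injective _≡_ _≡_ next
  next-injective {inj₁ a} {inj₁ b} e = cong inj₁ (begin
    a                                    ≡⟨ sym (inverseˡ (σ zero)) ⟩
    σ zero ⟨$⟩ˡ (σ zero ⟨$⟩ʳ a)          ≡⟨ cong (σ zero ⟨$⟩ˡ_) (Sumₚ.inj₂-injective e) ⟩
    σ zero ⟨$⟩ˡ (σ zero ⟨$⟩ʳ b)          ≡⟨ inverseˡ (σ zero) ⟩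
    b                                    ∎)
    where open ≡-Reasoning
  next-injective {inj₂ a} {inj₂ b} e = cong inj₂ (begin
    a                                    ≡⟨ sym (inverseʳ (σ (suc c))) ⟩
    σ (suc c) ⟨$⟩ʳ (σ (suc c) ⟨$⟩ˡ a)    ≡⟨ cong (σ (suc c) ⟨$⟩ʳ_) (Sumₚ.inj₁-injective e) ⟩
    σ (suc c) ⟨$⟩ʳ (σ (suc c) ⟨$⟩ˡ b)    ≡⟨ inverseʳ (σ (suc c)) ⟩
    b                                    ∎)
    where open ≡-Reasoning
  next-injective {inj₁ _} {inj₂ _} ()
  next-injective {inj₂ _} {inj₁ _} ()

  next-periodic : ∀ u → ∃ λ p → iterate next u (suc p) ≡ u
  next-periodic = periodic (join m m) (join-injective m) next next-injective

  open Orbits _≟V_ next next-injective next-periodic public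

  private
    Reach0c : Vert m → Vert m → Set
    Reach0c = Reach σ (colours0c c)

  step-next : ∀ u → Reach0c u (next u)
  step-next (inj₁ b) = bw zero b (inj₁ refl) ◅ ε
  step-next (inj₂ w) = step-from-white σ (suc c) w (inj₂ refl) ◅ ε

  step⇒orbit : ∀ {u v} → Step σ (colours0c c) u v → Orbit u v
  step⇒orbit (bw .zero    b (inj₁ refl)) = orbit-step
  step⇒orbit (bw .(suc c) b (inj₂ refl)) = orbit-sym (1 , cong inj₁ (inverseˡ (σ (suc c))))
  step⇒orbit (wb .zero    b (inj₁ refl)) = orbit-sym orbit-step
  step⇒orbit (wb .(suc c) b (inj₂ refl)) = 1 , cong inj₁ (inverseˡ (σ (suc c)))

  orbit⇔reach : ∀ u v → Orbit u v ⇔ Reach0c u v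
  orbit⇔reach u v = mk⇔ orbit⇒reach (Star.fold _ (λ st o → orbit-trans (step⇒orbit st) o) orbit-refl)
    where
      iterate⇒reach : ∀ n u → Reach0c u (iterate next u n)
      iterate⇒reach zero    u = ε
      iterate⇒reach (suc n) u = step-next u ◅◅ iterate⇒reach n (next u)
      orbit⇒reach : ∀ {u v} → Orbit u v → Reach0c u v
      orbit⇒reach {u} (n , refl) = iterate⇒reach n u

  -- Abstract: only the existence of a count matters, and unfolding the
  -- labelling during type checking is expensive.
  abstract
    cycle-count : ∃ λ k → Classes Orbit k
    cycle-count = classes-⊎ m Orbit (record { refl = orbit-refl ; sym = orbit-sym ; trans = orbit-trans }) orbit?

  numComponents : ∀ {k} → Classes Orbit k → NumComponents σ (colours0c c) k
  numComponents = classes-resp orbit⇔reach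

module CutSides {d : ℕ} (G : ColGraph d) (E : Fin (suc d) → Fin (ColGraph.size G) → Set)
    (cut : IsEdgeCut G E) where

  open ColGraph G using (σ) renaming (size to m)

  _~_ : Vert m → Vert m → Set
  _~_ = Reach σ (removing E)

  E-without : Fin (suc d) → Fin m → Fin (suc d) → Fin m → Set
  E-without c₀ b₀ c b = E c b × ¬ (c ≡ c₀ × b ≡ b₀)

  ToEndpoint : Fin (suc d) → Fin m → Vert m → Set
  ToEndpoint c₀ b₀ u = u ~ inj₁ b₀ ⊎ u ~ inj₂ (σ c₀ ⟨$⟩ʳ b₀)

  prepend : ∀ {c₀ b₀ u v w} → Step σ (removing E) u v → v ~ w ⊎ ToEndpoint c₀ b₀ v → u ~ w ⊎ ToEndpoint c₀ b₀ u
  prepend st = Sum.map (st ◅_) (Sum.map (st ◅_) (st ◅_))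

  reach-without : ∀ c₀ b₀ {u w} → Reach σ (removing (E-without c₀ b₀)) u w → u ~ w ⊎ ToEndpoint c₀ b₀ u
  reach-without c₀ b₀ ε = inj₁ ε
  reach-without c₀ b₀ (bw c b kept ◅ path) with c Finₚ.≟ c₀ ×-dec b Finₚ.≟ b₀
  ... | yes (refl , refl) = inj₂ (inj₁ ε)
  ... | no other          = prepend (bw c b (λ e → kept (e , other))) (reach-without c₀ b₀ path)
  reach-without c₀ b₀ (wb c b kept ◅ path) with c Finₚ.≟ c₀ ×-dec b Finₚ.≟ b₀
  ... | yes (refl , refl) = inj₂ (inj₂ ε)
  ... | no other          = prepend (wb c b (λ e → kept (e , other))) (reach-without c₀ b₀ path)

  connected-without : ∀ {c₀ b₀} → E c₀ b₀ → Connected σ (removing (E-without c₀ b₀))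
  connected-without e₀ = proj₂ cut (E-without _ _) proj₁ (λ E⊆ → proj₂ (E⊆ e₀) (refl , refl))

  -- The endpoints of a cut edge are separated by the cut, for otherwise
  -- every vertex would be connected to b₀ in G − E.
  endpoints-separated : ∀ {c₀ b₀} → E c₀ b₀ → ¬ inj₁ b₀ ~ inj₂ (σ c₀ ⟨$⟩ʳ b₀)
  endpoints-separated {c₀} {b₀} e₀ joined = proj₁ cut (λ u w → to-b₀ u ◅◅ reach-sym (to-b₀ w))
    where
      to-b₀ : ∀ u → u ~ inj₁ b₀
      to-b₀ u with reach-without c₀ b₀ (connected-without e₀ u (inj₁ b₀))
      ... | inj₁ path        = path
      ... | inj₂ (inj₁ path) = path
      ... | inj₂ (inj₂ path) = path ◅◅ reach-sym joined

  -- Fixing a cut edge e₀ = (c₀, b₀), every vertex is joined in G − E to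
  -- one of its endpoints; which one is the side of the vertex.
  module Sides {c₀ b₀} (e₀ : E c₀ b₀) where

    private
      tag : ∀ {u} → ToEndpoint c₀ b₀ u → Bool
      tag = Sum.[ (λ _ → true) , (λ _ → false) ]′

      same-tag⇒~ : ∀ {u w} (a : ToEndpoint c₀ b₀ u) (b : ToEndpoint c₀ b₀ w) → tag a ≡ tag b → u ~ w
      same-tag⇒~ (inj₁ a) (inj₁ b) _ = a ◅◅ reach-sym b
      same-tag⇒~ (inj₂ a) (inj₂ b) _ = a ◅◅ reach-sym b
      same-tag⇒~ (inj₁ _) (inj₂ _) ()
      same-tag⇒~ (inj₂ _) (inj₁ _) ()

      ~⇒same-tag : ∀ {u w} (a : ToEndpoint c₀ b₀ u) (b : ToEndpoint c₀ b₀ w) → u ~ w → tag a ≡ tag b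
      ~⇒same-tag (inj₁ _) (inj₁ _) _    = refl
      ~⇒same-tag (inj₂ _) (inj₂ _) _    = refl
      ~⇒same-tag (inj₁ a) (inj₂ b) path = contradiction (reach-sym a ◅◅ path ◅◅ b) (endpoints-separated e₀)
      ~⇒same-tag (inj₂ a) (inj₁ b) path = contradiction (reach-sym b ◅◅ reach-sym path ◅◅ a) (endpoints-separated e₀)

    abstract
      toward : ∀ u → ToEndpoint c₀ b₀ u
      toward u = Sum.[ inj₁ , (λ t → t) ]′ (reach-without c₀ b₀ (connected-without e₀ u (inj₁ b₀)))

    side : Vert m → Bool
    side u = tag (toward u)

    same-side⇒~ : ∀ {u w} → side u ≡ side w → u ~ w
    same-side⇒~ {u} {w} = same-tag⇒~ (toward u) (toward w)

    ~⇒same-side : ∀ {u w} → u ~ w → side u ≡ side w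
    ~⇒same-side {u} {w} = ~⇒same-tag (toward u) (toward w)

    module _ (E? : ∀ c b → Dec (E c b)) where

      crossing-black : ∀ c b → side (inj₁ b) ≢ side (inj₂ (σ c ⟨$⟩ʳ b)) → E c b
      crossing-black c b opposite with E? c b
      ... | yes e = e
      ... | no ∉E = contradiction (~⇒same-side (bw c b ∉E ◅ ε)) opposite

      crossing-white : ∀ c w → side (inj₂ w) ≢ side (inj₁ (σ c ⟨$⟩ˡ w)) → E c (σ c ⟨$⟩ˡ w)
      crossing-white c w opposite with E? c (σ c ⟨$⟩ˡ w)
      ... | yes e = e
      ... | no ∉E = contradiction (~⇒same-side (step-from-white σ c w ∉E ◅ ε)) opposite

∑ : ∀ {d} → (Fin d → ℕ) → ℕ
∑ f = sum (tabulate f)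

∑-+ : ∀ {d} (f g : Fin d → ℕ) → ∑ (λ c → f c + g c) ≡ ∑ f + ∑ g
∑-+ {zero}  f g = refl
∑-+ {suc d} f g = begin
  (f zero + g zero) + ∑ (λ c → f (suc c) + g (suc c))  ≡⟨ cong (f zero + g zero +_) (∑-+ (λ c → f (suc c)) (λ c → g (suc c))) ⟩
  (f zero + g zero) + (∑ (λ c → f (suc c)) + ∑ (λ c → g (suc c)))
    ≡⟨ solve 4 (λ a b c e → (a :+ b) :+ (c :+ e) := (a :+ c) :+ (b :+ e)) refl (f zero) (g zero) _ _ ⟩
  (f zero + ∑ (λ c → f (suc c))) + (g zero + ∑ (λ c → g (suc c)))  ∎
  where open ≡-Reasoning
        open +-*-Solver

∑-mono-≤ : ∀ {d} {f g : Fin d → ℕ} → (∀ c → f c ≤ g c) → ∑ f ≤ ∑ g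
∑-mono-≤ {zero}  f≤g = z≤n
∑-mono-≤ {suc d} f≤g = +-mono-≤ (f≤g zero) (∑-mono-≤ (λ c → f≤g (suc c)))

∑-cong : ∀ {d} {f g : Fin d → ℕ} → (∀ c → f c ≡ g c) → ∑ f ≡ ∑ g
∑-cong f≗g = cong sum (tabulate-cong f≗g)

∑-ones : ∀ d → ∑ {d} (λ _ → 1) ≡ d
∑-ones zero    = refl
∑-ones (suc d) = cong suc (∑-ones d)

double-even : ∀ a → (a + a) % 2 ≡ 0
double-even zero    = refl
double-even (suc a) = trans (cong (λ z → suc z % 2) (+-suc a a)) (double-even a)

odd-split : ∀ {a b d} → a + b ≡ d → d % 2 ≡ 1 → a ≤ b → suc (a + a) ≤ d
odd-split {a} refl odd a≤b =
  ≤∧≢⇒< (+-monoʳ-≤ a a≤b) (λ 2a≡d → 0≢1+n (trans (sym (double-even a)) (trans (cong (_% 2) 2a≡d) odd)))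

four-halves : ∀ d A B C D → suc (A + A) ≤ d → suc (B + B) ≤ d → suc (C + C) ≤ d → suc (D + D) ≤ d →
              ¬ (d + d ≤ (A + B) + (C + D))
four-halves d A B C D hA hB hC hD big = <-irrefl refl (≤-trans (m≤n+m (suc (S + S)) 3) (begin
  4 + (S + S)                                                           ≡⟨ regroup ⟨
  suc (A + A) + suc (B + B) + (suc (C + C) + suc (D + D))               ≤⟨ +-mono-≤ (+-mono-≤ hA hB) (+-mono-≤ hC hD) ⟩
  (d + d) + (d + d)                                                     ≤⟨ +-mono-≤ big big ⟩
  S + S                                                                 ∎))
  where
    open ≤-Reasoning
    open +-*-Solver
    S = (A + B) + (C + D)
    regroup : suc (A + A) + suc (B + B) + (suc (C + C) + suc (D + D)) ≡ 4 + (S + S)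
    regroup = solve 4 (λ a b c e → (con 1 :+ (a :+ a)) :+ (con 1 :+ (b :+ b)) :+ ((con 1 :+ (c :+ c)) :+ (con 1 :+ (e :+ e)))
                                  := con 4 :+ (((a :+ b) :+ (c :+ e)) :+ ((a :+ b) :+ (c :+ e)))) refl A B C D

indicator : ∀ {P : Set} → Dec P → ℕ
indicator D = if does D then 1 else 0

indicator-yes : ∀ {P : Set} (D : Dec P) → P → indicator D ≡ 1
indicator-yes (yes _) _ = refl
indicator-yes (no ¬p) p = contradiction p ¬p

indicator-complement : ∀ {P : Set} (D : Dec P) → indicator D + indicator (¬? D) ≡ 1
indicator-complement (yes _) = refl
indicator-complement (no _)  = refl

-- The three kinds of splits of four points into two sides (given by
-- side : Fin 4 → Bool) that the counting argument distinguishes.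
data Shape (side : Fin 4 → Bool) : Set where
  one-sided : (∀ l → side l ≡ side 0F) → Shape side
  lonely    : ∀ j k → j ≢ k → (∀ l → side j ≢ side l → l ≡ k) → Shape side
  balanced  : ∀ p q r t → p ≢ r → p ≢ t → q ≢ r → q ≢ t →
              (∀ l → side p ≢ side l → l ≡ r ⊎ l ≡ t) →
              (∀ l → side q ≢ side l → l ≡ r ⊎ l ≡ t) → Shape side

quad : ∀ {A : Set} → A → A → A → A → Fin 4 → A
quad a _ _ _ 0F = a
quad _ b _ _ 1F = b
quad _ _ c _ 2F = c
quad _ _ _ e 3F = e

quad-injective : ∀ {A : Set} {a b c e : A} → a ≢ b → a ≢ c → a ≢ e → b ≢ c → b ≢ e → c ≢ e →
                 ∀ {j k} → quad a b c e j ≡ quad a b c e k → j ≡ k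
quad-injective ab ac ae bc be ce {0F} {0F} _ = refl
quad-injective ab ac ae bc be ce {1F} {1F} _ = refl
quad-injective ab ac ae bc be ce {2F} {2F} _ = refl
quad-injective ab ac ae bc be ce {3F} {3F} _ = refl
quad-injective ab ac ae bc be ce {0F} {1F} e = contradiction e ab
quad-injective ab ac ae bc be ce {0F} {2F} e = contradiction e ac
quad-injective ab ac ae bc be ce {0F} {3F} e = contradiction e ae
quad-injective ab ac ae bc be ce {1F} {2F} e = contradiction e bc
quad-injective ab ac ae bc be ce {1F} {3F} e = contradiction e be
quad-injective ab ac ae bc be ce {2F} {3F} e = contradiction e ce
quad-injective ab ac ae bc be ce {1F} {0F} e = contradiction (sym e) ab
quad-injective ab ac ae bc be ce {2F} {0F} e = contradiction (sym e) ac
quad-injective ab ac ae bc be ce {3F} {0F} e = contradiction (sym e) ae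
quad-injective ab ac ae bc be ce {2F} {1F} e = contradiction (sym e) bc
quad-injective ab ac ae bc be ce {3F} {1F} e = contradiction (sym e) be
quad-injective ab ac ae bc be ce {3F} {2F} e = contradiction (sym e) ce

shape-resp : ∀ {f g : Fin 4 → Bool} → (∀ j l → f j ≡ f l → g j ≡ g l) → Shape f → Shape g
shape-resp same (one-sided all) = one-sided (λ l → same l 0F (all l))
shape-resp same (lonely j k j≢k only) = lonely j k j≢k (λ l opp → only l (λ e → opp (same j l e)))
shape-resp same (balanced p q r t pr pt qr qt onlyp onlyq) =
  balanced p q r t pr pt qr qt (λ l opp → onlyp l (λ e → opp (same p l e))) (λ l opp → onlyq l (λ e → opp (same q l e)))

private
  opposite-within? : (side : Fin 4 → Bool) (j : Fin 4) (P : Fin 4 → Set) → (∀ l → Dec (P l)) →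
                     Dec (∀ l → side j ≢ side l → P l)
  opposite-within? side j P P? = Finₚ.all? (λ l → ¬? (side j Boolₚ.≟ side l) →-dec P? l)

  lonely! : ∀ {side} j k {_ : True (¬? (j Finₚ.≟ k))}
            {_ : True (opposite-within? side j (_≡ k) (Finₚ._≟ k))} → Shape side
  lonely! j k {j≢k} {only} = lonely j k (toWitness j≢k) (toWitness only)

  balanced! : ∀ {side} p q r t {_ : True (¬? (p Finₚ.≟ r))} {_ : True (¬? (p Finₚ.≟ t))}
              {_ : True (¬? (q Finₚ.≟ r))} {_ : True (¬? (q Finₚ.≟ t))}
              {_ : True (opposite-within? side p (λ l → l ≡ r ⊎ l ≡ t) (λ l → (l Finₚ.≟ r) ⊎-dec (l Finₚ.≟ t)))}
              {_ : True (opposite-within? side q (λ l → l ≡ r ⊎ l ≡ t) (λ l → (l Finₚ.≟ r) ⊎-dec (l Finₚ.≟ t)))} →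
              Shape side
  balanced! p q r t {pr} {pt} {qr} {qt} {onlyp} {onlyq} =
    balanced p q r t (toWitness pr) (toWitness pt) (toWitness qr) (toWitness qt) (toWitness onlyp) (toWitness onlyq)

  shape-true : ∀ b c e → Shape (quad true b c e)
  shape-true true  true  true  = one-sided (λ { 0F → refl ; 1F → refl ; 2F → refl ; 3F → refl })
  shape-true true  true  false = lonely! 0F 3F
  shape-true true  false true  = lonely! 0F 2F
  shape-true false true  true  = lonely! 0F 1F
  shape-true false false false = lonely! 1F 0F
  shape-true true  false false = balanced! 0F 1F 2F 3F
  shape-true false true  false = balanced! 0F 2F 1F 3F
  shape-true false false true  = balanced! 0F 3F 1F 2F

  -- Flipping all sides keeps the shape.
  shape-of : ∀ a b c e → Shape (quad a b c e)
  shape-of true  b c e = shape-true b c e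
  shape-of false b c e = shape-resp unflip (shape-true (not b) (not c) (not e))
    where
      flipped : ∀ l → quad true (not b) (not c) (not e) l ≡ not (quad false b c e l)
      flipped 0F = refl
      flipped 1F = refl
      flipped 2F = refl
      flipped 3F = refl
      unflip : ∀ j l → quad true (not b) (not c) (not e) j ≡ quad true (not b) (not c) (not e) l →
               quad false b c e j ≡ quad false b c e l
      unflip j l e = Boolₚ.not-injective (trans (sym (flipped j)) (trans e (flipped l)))

shape : (side : Fin 4 → Bool) → Shape side
shape side = shape-resp same (shape-of (side 0F) (side 1F) (side 2F) (side 3F))
  where
    tabulated : ∀ l → quad (side 0F) (side 1F) (side 2F) (side 3F) l ≡ side l
    tabulated 0F = refl
    tabulated 1F = refl
    tabulated 2F = refl
    tabulated 3F = refl
    same : ∀ j l → quad (side 0F) (side 1F) (side 2F) (side 3F) j ≡ quad (side 0F) (side 1F) (side 2F) (side 3F) l →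
           side j ≡ side l
    same j l e = trans (sym (tabulated j)) (trans e (tabulated l))

-- I c j k counts whether points j and k share a
-- c-cycle; N j k sums this over all colours.
module FourPoints {d : ℕ} (I : Fin d → Fin 4 → Fin 4 → ℕ)
    (bound : ∀ j k → j ≢ k → suc (∑ (λ c → I c j k) + ∑ (λ c → I c j k)) ≤ d)
    (side : Fin 4 → Bool) (cover : ∀ c j → ∃ λ k → side j ≢ side k × I c j k ≡ 1) where

  N : Fin 4 → Fin 4 → ℕ
  N j k = ∑ (λ c → I c j k)

  no-one-sided : Fin d → ¬ (∀ l → side l ≡ side 0F)
  no-one-sided c all with cover c 0F
  ... | k , opp , _ = opp (sym (all k))

  -- j would share all d cycles with k.
  no-lonely : ∀ j k → j ≢ k → ¬ (∀ l → side j ≢ side l → l ≡ k)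
  no-lonely j k j≢k only = <-irrefl refl (≤-trans (s≤s (m≤m+n (N j k) (N j k))) (≤-trans (bound j k j≢k) d≤N))
    where
      always : ∀ c → I c j k ≡ 1
      always c with cover c j
      ... | l , opp , I≡1 = subst (λ z → I c j z ≡ 1) (only l opp) I≡1
      d≤N : d ≤ N j k
      d≤N = subst (_≤ N j k) (∑-ones d) (∑-mono-≤ (λ c → ≤-reflexive (sym (always c))))

  -- p and q would together share at least 2d cycles with r and t.
  no-balanced : ∀ p q r t → p ≢ r → p ≢ t → q ≢ r → q ≢ t →
                (∀ l → side p ≢ side l → l ≡ r ⊎ l ≡ t) →
                ¬ (∀ l → side q ≢ side l → l ≡ r ⊎ l ≡ t)
  no-balanced p q r t pr pt qr qt onlyp onlyq =
    four-halves d (N p r) (N p t) (N q r) (N q t) (bound p r pr) (bound p t pt) (bound q r qr) (bound q t qt) (begin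
      d + d                                                ≡⟨ cong₂ _+_ (∑-ones d) (∑-ones d) ⟨
      ∑ {d} (λ _ → 1) + ∑ {d} (λ _ → 1)                      ≡⟨ ∑-+ {d} (λ _ → 1) (λ _ → 1) ⟨
      ∑ {d} (λ _ → 1 + 1)                                  ≤⟨ ∑-mono-≤ (λ c → +-mono-≤ (meets c p onlyp) (meets c q onlyq)) ⟩
      ∑ (λ c → (I c p r + I c p t) + (I c q r + I c q t))  ≡⟨ ∑-+ (λ c → I c p r + I c p t) (λ c → I c q r + I c q t) ⟩
      ∑ (λ c → I c p r + I c p t) + ∑ (λ c → I c q r + I c q t)
        ≡⟨ cong₂ _+_ (∑-+ (λ c → I c p r) (λ c → I c p t)) (∑-+ (λ c → I c q r) (λ c → I c q t)) ⟩
      (N p r + N p t) + (N q r + N q t)                    ∎)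
    where
      open ≤-Reasoning
      meets : ∀ c j → (∀ l → side j ≢ side l → l ≡ r ⊎ l ≡ t) → 1 ≤ I c j r + I c j t
      meets c j only with cover c j
      ... | l , opp , I≡1 with only l opp
      ...   | inj₁ refl = subst (λ z → 1 ≤ z + I c j t) (sym I≡1) (s≤s z≤n)
      ...   | inj₂ refl = subst (λ z → 1 ≤ I c j r + z) (sym I≡1) (m≤n+m 1 (I c j r))

  impossible : Fin d → ⊥
  impossible c with shape side
  ... | one-sided all                                = no-one-sided c all
  ... | lonely j k j≢k only                          = no-lonely j k j≢k only
  ... | balanced p q r t pr pt qr qt onlyp onlyq     = no-balanced p q r t pr pt qr qt onlyp onlyq

third : ∀ {n} (j k : Fin (suc (suc (suc n)))) → ∃ λ l → l ≢ j × l ≢ k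
third j k with j Finₚ.≟ k
... | yes refl = punchIn j zero , Finₚ.punchInᵢ≢i j zero , Finₚ.punchInᵢ≢i j zero
... | no j≢k   = punchIn j (punchIn k′ zero) , Finₚ.punchInᵢ≢i j _ , misses-k
  where
    k′ = punchOut j≢k
    misses-k : punchIn j (punchIn k′ zero) ≢ k
    misses-k l≡k = Finₚ.punchInᵢ≢i k′ zero
                     (Finₚ.punchIn-injective j _ _ (trans l≡k (sym (Finₚ.punchIn-punchOut j≢k))))

transpose-left : ∀ {m} (x y : Fin m) → transpose x y ⟨$⟩ʳ x ≡ y
transpose-left x y rewrite dec-true (x Finₚ.≟ x) refl = refl

transpose-right : ∀ {m} (x y : Fin m) → x ≢ y → transpose x y ⟨$⟩ʳ y ≡ x
transpose-right x y x≢y rewrite dec-false (y Finₚ.≟ x) (x≢y ∘ sym) | dec-true (y Finₚ.≟ y) refl = refl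

transpose-other : ∀ {m} (x y b : Fin m) → b ≢ x → b ≢ y → transpose x y ⟨$⟩ʳ b ≡ b
transpose-other x y b b≢x b≢y rewrite dec-false (b Finₚ.≟ x) b≢x | dec-false (b Finₚ.≟ y) b≢y = refl

module FourCut {d : ℕ} (odd : d % 2 ≡ 1) (some-colour : Fin d)
    {N : ℕ} (B : Fin N → Bubble d) (ns : Fin N → ℕ) (G : ColGraph d) (maximal : In𝒢max B ns G)
    (point : Fin 4 → Fin (ColGraph.size G)) (point-injective : ∀ {j k} → point j ≡ point k → j ≡ k)
    (cut : IsEdgeCut G (Colour0Edges4 (point 0F) (point 1F) (point 2F) (point 3F))) where

  open ColGraph G using (σ) renaming (size to m)

  E : Fin (suc d) → Fin m → Set
  E = Colour0Edges4 (point 0F) (point 1F) (point 2F) (point 3F)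

  E? : ∀ c b → Dec (E c b)
  E? c b = (c Finₚ.≟ zero) ×-dec ((b Finₚ.≟ point 0F) ⊎-dec ((b Finₚ.≟ point 1F) ⊎-dec
                                  ((b Finₚ.≟ point 2F) ⊎-dec (b Finₚ.≟ point 3F))))

  cut-edge : ∀ j → E zero (point j)
  cut-edge 0F = refl , inj₁ refl
  cut-edge 1F = refl , inj₂ (inj₁ refl)
  cut-edge 2F = refl , inj₂ (inj₂ (inj₁ refl))
  cut-edge 3F = refl , inj₂ (inj₂ (inj₂ refl))

  cut-vertex : ∀ {c b} → E c b → ∃ λ j → b ≡ point j
  cut-vertex (_ , inj₁ e)               = 0F , e
  cut-vertex (_ , inj₂ (inj₁ e))        = 1F , e
  cut-vertex (_ , inj₂ (inj₂ (inj₁ e))) = 2F , e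
  cut-vertex (_ , inj₂ (inj₂ (inj₂ e))) = 3F , e

  open CutSides G E cut
  open Sides (cut-edge 0F)

  cut-edge-crosses : ∀ j → side (inj₁ (point j)) ≢ side (inj₂ (σ zero ⟨$⟩ʳ point j))
  cut-edge-crosses j same = endpoints-separated (cut-edge j) (same-side⇒~ same)

  module Cycles (c : Fin d) = BicolouredCycles σ c
  open Cycles using (next; Orbit; orbit?)

  crossing-step : ∀ c a → side a ≢ side (next c a) → ∃ λ k → a ≡ inj₁ (point k)
  crossing-step c (inj₁ b) opposite with cut-vertex (crossing-black E? zero b opposite)
  ... | k , b≡ = k , cong inj₁ b≡
  crossing-step c (inj₂ w) opposite with crossing-white E? (suc c) w opposite
  ... | () , _

  -- The {0,c}-cycle through a cut vertex leaves its side along the cut edge,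
  -- so it comes back through another cut vertex on the other side.
  module Return (c : Fin d) (j : Fin 4) where

    start : Vert m
    start = inj₁ (point j)

    later : ℕ → Vert m
    later i = iterate (next c) start (suc i)

    Back : ℕ → Set
    Back i = side (later i) ≡ side start

    switch : ∃ λ i → ¬ Back i × Back (suc i)
    switch = first-switch Back (λ i → side (later i) Boolₚ.≟ side start)
                          (λ e → cut-edge-crosses j (sym e))
                          (proj₁ (Cycles.next-periodic c start)) (cong side (proj₂ (Cycles.next-periodic c start)))

    cover : ∃ λ k → side start ≢ side (inj₁ (point k)) × Orbit c start (inj₁ (point k))
    cover with switch
    ... | i , away , back with crossing-step c (later i) (λ e → away (trans e (trans (cong side (sym (iterate-suc (next c) start (suc i)))) back)))
    ...   | k , later≡ = k , (λ e → away (trans (cong side later≡) (sym e))) , suc i , later≡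

  ks : Fin d → ℕ
  ks c = proj₁ (Cycles.cycle-count c)

  C₀ : HasC0 G (∑ ks)
  C₀ = ks , (λ c → Cycles.numComponents c (proj₂ (Cycles.cycle-count c))) , refl

  shares? : ∀ c j k → Dec (Orbit c (inj₁ (point j)) (inj₁ (point k)))
  shares? c j k = orbit? c (inj₁ (point j)) (inj₁ (point k))

  module Swap {j k : Fin 4} (j≢k : j ≢ k) where

    x y : Fin m
    x = point j
    y = point k

    x≢y : x ≢ y
    x≢y = j≢k ∘ point-injective

    σ′ : Fin (suc d) → Permutation′ m
    σ′ zero    = transpose x y ∘ₚ σ zero
    σ′ (suc c) = σ (suc c)

    -- The two swapped edges are a proper part of the cut, so G stays
    -- connected without them; all other edges survive in G′.
    Pair : Fin (suc d) → Fin m → Set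
    Pair c b = c ≡ zero × (b ≡ x ⊎ b ≡ y)

    pair-connected : Connected σ (removing Pair)
    pair-connected = proj₂ cut Pair pair⊆cut pair≢cut
      where
        pair⊆cut : ∀ {c b} → Pair c b → E c b
        pair⊆cut (refl , inj₁ refl) = cut-edge j
        pair⊆cut (refl , inj₂ refl) = cut-edge k
        pair≢cut : ¬ (∀ {c b} → E c b → Pair c b)
        pair≢cut cut⊆pair with third j k
        ... | l , l≢j , l≢k with proj₂ (cut⊆pair (cut-edge l))
        ...   | inj₁ e = l≢j (point-injective e)
        ...   | inj₂ e = l≢k (point-injective e)

    σ′-off-pair : ∀ b → ¬ Pair zero b → σ′ zero ⟨$⟩ʳ b ≡ σ zero ⟨$⟩ʳ b
    σ′-off-pair b ∉P = cong (σ zero ⟨$⟩ʳ_) (transpose-other x y b (λ e → ∉P (refl , inj₁ e)) (λ e → ∉P (refl , inj₂ e)))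

    kept-step : ∀ {u v} → Step σ (removing Pair) u v → Step σ′ allEdges u v
    kept-step (bw zero b ∉P)   = subst (λ z → Step σ′ allEdges (inj₁ b) (inj₂ z)) (σ′-off-pair b ∉P) (bw zero b tt)
    kept-step (wb zero b ∉P)   = subst (λ z → Step σ′ allEdges (inj₂ z) (inj₁ b)) (σ′-off-pair b ∉P) (wb zero b tt)
    kept-step (bw (suc c) b _) = bw (suc c) b tt
    kept-step (wb (suc c) b _) = wb (suc c) b tt

    G′ : ColGraph d
    G′ = record { size = m ; nonempty = ColGraph.nonempty G ; σ = σ′
                ; connected = λ u v → Star.map kept-step (pair-connected u v) }

    -- The bubbles (colours 1..d) are untouched, so G′ ∈ 𝒢.
    G′∈𝒢 : In𝒢 B ns G′
    G′∈𝒢 = proj₁ maximal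

    module Cycles′ (c : Fin d) = BicolouredCycles σ′ c

    ks′ : Fin d → ℕ
    ks′ c = proj₁ (Cycles′.cycle-count c)

    C₀′ : HasC0 G′ (∑ ks′)
    C₀′ = ks′ , (λ c → Cycles′.numComponents c (proj₂ (Cycles′.cycle-count c))) , refl

    -- For every colour, the cycle permutation of G′ is that of G composed
    -- with the transposition of the black vertices x and y.
    module PerColour (c : Fin d) where

      agree : ∀ u → u ≢ inj₁ x → u ≢ inj₁ y → next c u ≡ Cycles′.next c u
      agree (inj₁ b) b≢x b≢y = cong inj₂ (sym (σ′-off-pair b λ { (_ , inj₁ e) → b≢x (cong inj₁ e)
                                                               ; (_ , inj₂ e) → b≢y (cong inj₁ e) }))
      agree (inj₂ w) _ _ = refl

      moved-x : Cycles′.next c (inj₁ x) ≡ next c (inj₁ y)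
      moved-x = cong (λ b → inj₂ (σ zero ⟨$⟩ʳ b)) (transpose-left x y)

      moved-y : Cycles′.next c (inj₁ y) ≡ next c (inj₁ x)
      moved-y = cong (λ b → inj₂ (σ zero ⟨$⟩ʳ b)) (transpose-right x y x≢y)

      open Transposition _≟V_ (next c) (Cycles′.next c) (Cycles.next-injective c) (Cycles.next-periodic c)
                         (Cycles′.next-injective c) (Cycles′.next-periodic c)
                         (inj₁ x) (inj₁ y) (x≢y ∘ Sumₚ.inj₁-injective) agree moved-x moved-y public

    -- Per colour, the cycle count goes up by one if x and y shared a cycle
    -- and down by one otherwise.
    count-change : ∀ c → ks′ c + indicator (¬? (shares? c j k)) ≡ ks c + indicator (shares? c j k)
    count-change c with shares? c j k
    ... | yes joined   = trans (+-identityʳ (ks′ c))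
                               (trans (PerColour.count-joined c joined (proj₂ (Cycles.cycle-count c)) (proj₂ (Cycles′.cycle-count c)))
                                      (+-comm 1 (ks c)))
    ... | no separated = trans (+-comm (ks′ c) 1)
                               (trans (sym (PerColour.count-separated c separated (proj₂ (Cycles.cycle-count c)) (proj₂ (Cycles′.cycle-count c))))
                                      (sym (+-identityʳ (ks c))))

    joined separated : ℕ
    joined    = ∑ (λ c → indicator (shares? c j k))
    separated = ∑ (λ c → indicator (¬? (shares? c j k)))

    -- G maximises C₀, so the swap cannot gain cycles.
    fewer-joined : joined ≤ separated
    fewer-joined = +-cancelˡ-≤ (∑ ks) joined separated (begin
      ∑ ks + joined       ≡⟨ ∑-+ ks _ ⟨
      ∑ (λ c → ks c + indicator (shares? c j k))         ≡⟨ ∑-cong (λ c → sym (count-change c)) ⟩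
      ∑ (λ c → ks′ c + indicator (¬? (shares? c j k)))  ≡⟨ ∑-+ ks′ _ ⟩
      ∑ ks′ + separated   ≤⟨ +-monoˡ-≤ separated (proj₂ maximal G′ G′∈𝒢 (∑ ks) (∑ ks′) C₀ C₀′) ⟩
      ∑ ks + separated    ∎)
      where open ≤-Reasoning

    all-colours : joined + separated ≡ d
    all-colours = begin
      joined + separated                                                     ≡⟨ ∑-+ (λ c → indicator (shares? c j k)) _ ⟨
      ∑ (λ c → indicator (shares? c j k) + indicator (¬? (shares? c j k)))  ≡⟨ ∑-cong (λ c → indicator-complement (shares? c j k)) ⟩
      ∑ {d} (λ _ → 1)                                                        ≡⟨ ∑-ones d ⟩
      d                                                                      ∎
      where open ≡-Reasoning

    shared-few : suc (joined + joined) ≤ d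
    shared-few = odd-split all-colours odd fewer-joined

  impossible : ⊥
  impossible = FourPoints.impossible (λ c j k → indicator (shares? c j k)) (λ j k j≢k → Swap.shared-few j≢k)
                 (λ j → side (inj₁ (point j))) covered some-colour
    where
      covered : ∀ c j → ∃ λ k → side (inj₁ (point j)) ≢ side (inj₁ (point k)) × indicator (shares? c j k) ≡ 1
      covered c j = let (k , opposite , shared) = Return.cover c j in
                    k , opposite , indicator-yes (shares? c j k) shared

proposition5 : (d : ℕ) → d % 2 ≡ 1 →
               {N : ℕ} (B : Fin N → Bubble d) (ns : Fin N → ℕ) → (∀ i → 1 ≤ ns i) →
               (G : ColGraph d) → In𝒢max B ns G → ¬ HasColour0FourEdgeCut G
proposition5 zero () B ns _ G maximal
proposition5 (suc d) odd B ns _ G maximal (b₁ , b₂ , b₃ , b₄ , d₁₂ , d₁₃ , d₁₄ , d₂₃ , d₂₄ , d₃₄ , cut) =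
  FourCut.impossible odd zero B ns G maximal (quad b₁ b₂ b₃ b₄) (quad-injective d₁₂ d₁₃ d₁₄ d₂₃ d₂₄ d₃₄) cut
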